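{- Let $\mathcal{D}$ be a binary $q$-Steiner triple system $S_2[2,3,v]$, i.e. a set of $3$-dimensional subspaces (blocks) of $\mathbb{F}_2^v$ such that every $2$-dimensional subspace is contained in exactly one block. Let $A\in\mathrm{GL}(v,2)$ be an automorphism of $\mathcal{D}$ of order $2$ which is conjugate to $A_{v,s}$, where $A_{v,s}$ is the $v\times v$ block diagonal matrix consisting of $s$ blocks $\begin{pmatrix}0&1\\1&0\end{pmatrix}$ followed by a $(v-2s)\times(v-2s)$ identity matrix. Then each block of $\mathcal{D}$ fixed by $\langle A\rangle$ contains either $3$ or $7$ points (1-dimensional subspaces) fixed by $A$. The number of fixed blocks containing exactly $3$ fixed points is \[F_3=2^{v-s-2}(2^s-1),\] and the number of fixed blocks containing exactly $7$ fixed points is \[F_7=\frac{2^{2v-2s-1}+1-3\cdot 2^{v-s-2}(2^s+1)}{21}.\]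
   Context: Vectors are row vectors and $A$ acts on subspaces by $U\mapsto UA=\{\mathbf{u}A:\mathbf{u}\in U\}$; $A$ is an automorphism of $\mathcal{D}$ if it maps $\mathcal{D}$ onto itself. A subspace $U$ is fixed if $UA=U$. -}

module Defs where

open import Data.Bool using (Bool; true; false; _∧_; _∨_; not; _xor_; if_then_else_)
open import Data.Nat using (ℕ; zero; suc; _+_; _*_; _^_; _<ᵇ_; _≡ᵇ_; _/_)
open import Data.Fin using (Fin; toℕ)
open import Data.List using (List; []; _∷_; _++_; map; length; filterᵇ)
open import Data.Bool.ListAction using (all; any)
open import Data.List.Relation.Unary.All using (All)
open import Data.List.Membership.Propositional using (_∈_)
open import Data.Vec using (Vec; []; _∷_; replicate; zipWith; tabulate)
open import Data.Product using (Σ; _×_; ∃)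
open import Relation.Binary.PropositionalEquality using (_≡_)
open import Relation.Nullary using (¬_)

-- Vectors of F₂^v (row vectors); F₂ = Bool with xor as addition, ∧ as product.
F2V : ℕ → Set
F2V v = Vec Bool v

_⊕_ : ∀ {v} → F2V v → F2V v → F2V v
_⊕_ = zipWith _xor_

zeroV : ∀ v → F2V v
zeroV v = replicate v false

eqV : ∀ {v} → F2V v → F2V v → Bool
eqV [] [] = true
eqV (a ∷ x) (b ∷ y) = not (a xor b) ∧ eqV x y

isZero : ∀ {v} → F2V v → Bool
isZero x = eqV x (zeroV _)

allVecs : ∀ v → List (F2V v)
allVecs zero = [] ∷ []
allVecs (suc v) = map (false ∷_) (allVecs v) ++ map (true ∷_) (allVecs v)

-- v × v matrices over F₂, as a vector of rows
Mat : ℕ → Set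
Mat v = Vec (Vec Bool v) v

vecMat : ∀ {m n} → Vec Bool m → Vec (Vec Bool n) m → Vec Bool n
vecMat {n = n} [] [] = replicate n false
vecMat {n = n} (b ∷ x) (r ∷ A) = (if b then r else replicate n false) ⊕ vecMat x A

_·_ : ∀ {v} → Mat v → Mat v → Mat v
A · B = Data.Vec.map (λ r → vecMat r B) A

idMat : ∀ v → Mat v
idMat v = tabulate λ i → tabulate λ j → toℕ i ≡ᵇ toℕ j

IsInvertible : ∀ {v} → Mat v → Set
IsInvertible {v} A = Σ (Mat v) λ B → (A · B ≡ idMat v) × (B · A ≡ idMat v)

-- A_{v,s}: s diagonal blocks [[0,1],[1,0]] followed by the identity of size v-2s.
-- Entry (a,b): for a < 2s it is 1 iff a ≠ b lie in the same pair {2k,2k+1}; otherwise δ_ab.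
Avs : ∀ v → ℕ → Mat v
Avs v s = tabulate λ i → tabulate λ j → entry (toℕ i) (toℕ j)
  where
  entry : ℕ → ℕ → Bool
  entry a b = if a <ᵇ (2 * s) then ((a / 2) ≡ᵇ (b / 2)) ∧ not (a ≡ᵇ b) else (a ≡ᵇ b)

Conjugate : ∀ {v} → Mat v → Mat v → Set
Conjugate {v} A B = Σ (Mat v) λ P → Σ (Mat v) λ Q →
  (P · Q ≡ idMat v) × (Q · P ≡ idMat v) × (A ≡ (Q · B) · P)

HasOrder2 : ∀ {v} → Mat v → Set
HasOrder2 {v} A = (A · A ≡ idMat v) × ¬ (A ≡ idMat v)

VSet : ℕ → Set
VSet v = F2V v → Bool

card : ∀ {v} → VSet v → ℕ
card {v} S = length (filterᵇ S (allVecs v))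

IsSubspace : ∀ {v} → VSet v → Set
IsSubspace {v} S = (S (zeroV v) ≡ true) ×
  (∀ x y → S x ≡ true → S y ≡ true → S (x ⊕ y) ≡ true)

-- k-dimensional subspace of F₂^v (a subspace of dimension k over F₂ has 2^k elements)
IsSubspaceOfDim : ∀ {v} → ℕ → VSet v → Set
IsSubspaceOfDim k S = IsSubspace S × (card S ≡ 2 ^ k)

_⊆ᵇ_ : ∀ {v} → VSet v → VSet v → Bool
_⊆ᵇ_ {v} U W = all (λ x → not (U x) ∨ W x) (allVecs v)

_≐_ : ∀ {v} → VSet v → VSet v → Set
S ≐ T = ∀ x → S x ≡ T x

-- binary q-Steiner triple system S_2[2,3,v]: a collection (list) of 3-dim subspaces
-- such that every 2-dim subspace lies in exactly one of them (as list entries;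
-- this also forces the list to be duplicate-free).
IsQSTS : ∀ v → List (VSet v) → Set
IsQSTS v D = All (IsSubspaceOfDim 3) D ×
  (∀ (U : VSet v) → IsSubspaceOfDim 2 U → length (filterᵇ (U ⊆ᵇ_) D) ≡ 1)

image : ∀ {v} → Mat v → VSet v → VSet v
image {v} A U y = any (λ x → U x ∧ eqV (vecMat x A) y) (allVecs v)

IsAutomorphism : ∀ {v} → Mat v → List (VSet v) → Set
IsAutomorphism A D =
  (∀ B → B ∈ D → ∃ λ B' → (B' ∈ D) × (image A B ≐ B')) ×
  (∀ B' → B' ∈ D → ∃ λ B → (B ∈ D) × (image A B ≐ B'))

-- B is fixed by A (equivalently by ⟨A⟩), decided by enumeration: BA = B
fixedᵇ : ∀ {v} → Mat v → VSet v → Bool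
fixedᵇ {v} A B = all (λ x → not (image A B x xor B x)) (allVecs v)

-- number of points (1-dim subspaces = nonzero vectors over F₂) in B fixed by A
fixedPoints : ∀ {v} → Mat v → VSet v → ℕ
fixedPoints {v} A B =
  length (filterᵇ (λ x → B x ∧ not (isZero x) ∧ eqV (vecMat x A) x) (allVecs v))

F : ∀ {v} → Mat v → List (VSet v) → ℕ → ℕ
F A D k = length (filterᵇ (λ B → fixedᵇ A B ∧ (fixedPoints A B ≡ᵇ k)) D)

-- The vectors fixed by A form a subspace with 2^(v-s) elements, because A is conjugate to A_{v,s},
-- which swaps s pairs of coordinates. A block B fixed by A contains either 8 or exactly 4 fixed
-- vectors: if some x₀ in B is moved, translation by x₀ sends the fixed vectors of B to moved ones,
-- while the fixed vector x₀ + x₀A lies in a plane of fixed vectors inside B. The counts then come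
-- from double counting. A moved vector x lies together with xA in a unique block; that block is
-- fixed, so it has 3 fixed points and 4 moved vectors, whence 2^v - 2^(v-s) = 4 F₃. An ordered
-- pair of distinct fixed points lies in a unique block, again fixed, whence
-- (2^(v-s) - 1)(2^(v-s) - 2) = 6 F₃ + 42 F₇.

module Submission where

open import Defs
open import Level using (Level)
open import Algebra.Bundles using (CommutativeRing)
open import Data.Bool using (Bool; true; false; _∧_; _∨_; not; _xor_; if_then_else_; T)
open import Data.Bool.Properties
  using (T-≡; ⇔→≡; not-injective; ∧-assoc; ∧-comm; ∧-zeroʳ; ∧-identityʳ; ∧-conicalˡ; ∧-conicalʳ;
         xor-comm; xor-assoc; xor-same; xor-identityˡ; xor-identityʳ; xor-∧-commutativeRing)
open import Data.Bool.ListAction using (all; any)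
open import Data.Empty using (⊥; ⊥-elim)
open import Data.Fin using (toℕ)
open import Data.List using (List; []; _∷_; _++_; map; length; filterᵇ)
open import Data.List.Membership.Propositional using (_∈_)
open import Data.List.Membership.Propositional.Properties using (∈-filter⁺; ∈-map⁺; ∈-++⁺ˡ; ∈-++⁺ʳ)
open import Data.List.Relation.Unary.All as All using ([]; _∷_)
open import Data.List.Relation.Unary.All.Properties using (All¬⇒¬Any; all⁺; all⁻)
open import Data.List.Relation.Unary.Any as Any using (here; there)
open import Data.List.Relation.Unary.Any.Properties using (any⁺; any⁻)
open import Data.List.Relation.Unary.Unique.Propositional using (Unique; []; _∷_)
open import Data.Nat using (ℕ; zero; suc; pred; _+_; _*_; _∸_; _^_; _≤_; _<_; _<ᵇ_; _≡ᵇ_; _/_; z≤n; s≤s)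
open import Data.Nat.DivMod using (m/n≡1+[m∸n]/n)
open import Data.Nat.Properties
open import Data.Nat.Tactic.RingSolver using (solve-∀)
open import Data.Product using (∃; ∃₂; _×_; _,_; proj₁; proj₂)
open import Data.Sum using (_⊎_; inj₁; inj₂)
import Data.Sum as Sum
open import Data.Vec using (Vec; []; _∷_; tabulate)
import Data.Vec as Vec
open import Data.Vec.Properties
  using (zipWith-comm; zipWith-assoc; zipWith-identityˡ; zipWith-identityʳ;
         tabulate-∘; tabulate-cong; map-cong; map-id)
open import Function.Bundles using (Equivalence; mk⇔)
open import Relation.Nullary using (contradiction)
open import Relation.Nullary.Decidable using (T?)
open import Relation.Binary.PropositionalEquality
open import Algebra.Properties.CommutativeSemigroup
  (CommutativeRing.+-commutativeSemigroup xor-∧-commutativeRing) using (interchange)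

private variable
  ℓ : Level
  X Y : Set ℓ
  m n v : ℕ

-- Counting

⟦_⟧ : Bool → ℕ
⟦ true ⟧ = 1
⟦ false ⟧ = 0

⟦∧⟧ : ∀ p q → ⟦ p ∧ q ⟧ ≡ ⟦ p ⟧ * ⟦ q ⟧
⟦∧⟧ false q = refl
⟦∧⟧ true q = sym (+-identityʳ ⟦ q ⟧)

⟦⟧-split : ∀ p q → ⟦ p ⟧ ≡ ⟦ p ∧ q ⟧ + ⟦ p ∧ not q ⟧
⟦⟧-split false q = refl
⟦⟧-split true false = refl
⟦⟧-split true true = refl

fromT : ∀ {b} → T b → b ≡ true
fromT = Equivalence.to T-≡

toT : ∀ {b} → b ≡ true → T b
toT = Equivalence.from T-≡

∧≡true : ∀ a {b} → a ∧ b ≡ true → a ≡ true × b ≡ true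
∧≡true true b≡true = refl , b≡true

false≢true : false ≢ true
false≢true ()

∑ : List X → (X → ℕ) → ℕ
∑ [] f = 0
∑ (x ∷ xs) f = f x + ∑ xs f

syntax ∑ xs (λ x → e) = ∑[ x ∈ xs ] e

length-filterᵇ : (p : X → Bool) (xs : List X) → length (filterᵇ p xs) ≡ ∑[ x ∈ xs ] ⟦ p x ⟧
length-filterᵇ p [] = refl
length-filterᵇ p (x ∷ xs) with p x
... | true = cong suc (length-filterᵇ p xs)
... | false = length-filterᵇ p xs

∑-++ : (xs ys : List X) (f : X → ℕ) → ∑ (xs ++ ys) f ≡ ∑ xs f + ∑ ys f
∑-++ [] ys f = refl
∑-++ (x ∷ xs) ys f = trans (cong (f x +_) (∑-++ xs ys f)) (sym (+-assoc (f x) _ _))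

∑-map : (g : X → Y) (xs : List X) (f : Y → ℕ) → ∑ (map g xs) f ≡ ∑[ x ∈ xs ] f (g x)
∑-map g [] f = refl
∑-map g (x ∷ xs) f = cong (f (g x) +_) (∑-map g xs f)

∑-cong-∈ : (xs : List X) {f g : X → ℕ} → (∀ {x} → x ∈ xs → f x ≡ g x) → ∑ xs f ≡ ∑ xs g
∑-cong-∈ [] f≗g = refl
∑-cong-∈ (x ∷ xs) f≗g = cong₂ _+_ (f≗g (here refl)) (∑-cong-∈ xs (λ x∈ → f≗g (there x∈)))


∑-cong : (xs : List X) {f g : X → ℕ} → (∀ x → f x ≡ g x) → ∑ xs f ≡ ∑ xs g
∑-cong xs f≗g = ∑-cong-∈ xs (λ {x} _ → f≗g x)

∑-zero : (xs : List X) → ∑[ x ∈ xs ] 0 ≡ 0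
∑-zero [] = refl
∑-zero (x ∷ xs) = ∑-zero xs

∑-distrib-+ : (xs : List X) (f g : X → ℕ) → ∑[ x ∈ xs ] (f x + g x) ≡ ∑ xs f + ∑ xs g
∑-distrib-+ [] f g = refl
∑-distrib-+ (x ∷ xs) f g =
  trans (cong (f x + g x +_) (∑-distrib-+ xs f g)) (+-interchange (f x) (g x) (∑ xs f) (∑ xs g))
  where
  +-interchange : ∀ a b c d → a + b + (c + d) ≡ a + c + (b + d)
  +-interchange = solve-∀

∑-*ˡ : (xs : List X) (c : ℕ) (f : X → ℕ) → ∑[ x ∈ xs ] (c * f x) ≡ c * ∑ xs f
∑-*ˡ [] c f = sym (*-zeroʳ c)
∑-*ˡ (x ∷ xs) c f = trans (cong (c * f x +_) (∑-*ˡ xs c f)) (sym (*-distribˡ-+ c (f x) _))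

∑-comm : (xs : List X) (ys : List Y) (f : X → Y → ℕ) →
  ∑[ x ∈ xs ] ∑[ y ∈ ys ] f x y ≡ ∑[ y ∈ ys ] ∑[ x ∈ xs ] f x y
∑-comm [] ys f = sym (∑-zero ys)
∑-comm (x ∷ xs) ys f = trans (cong (∑ ys (f x) +_) (∑-comm xs ys f))
  (sym (∑-distrib-+ ys (f x) (λ y → ∑[ x ∈ xs ] f x y)))

∑-mono-≤ : (xs : List X) {f g : X → ℕ} → (∀ x → f x ≤ g x) → ∑ xs f ≤ ∑ xs g
∑-mono-≤ [] f≤g = z≤n
∑-mono-≤ (x ∷ xs) f≤g = +-mono-≤ (f≤g x) (∑-mono-≤ xs f≤g)

∑⟦⟧-witness : (xs : List X) (p : X → Bool) → 0 < ∑[ x ∈ xs ] ⟦ p x ⟧ → ∃ λ x → p x ≡ true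
∑⟦⟧-witness (x ∷ xs) p pos with p x in px
... | true = x , px
... | false = ∑⟦⟧-witness xs p pos

filterᵇ-length≡1⇒unique : (p : X → Bool) (xs : List X) → length (filterᵇ p xs) ≡ 1 →
  ∀ {x y} → x ∈ xs → y ∈ xs → p x ≡ true → p y ≡ true → x ≡ y
filterᵇ-length≡1⇒unique p xs one x∈ y∈ px py =
  singleton (filterᵇ p xs) one (∈-filterᵇ x∈ px) (∈-filterᵇ y∈ py)
  where
  ∈-filterᵇ : ∀ {z} → z ∈ xs → p z ≡ true → z ∈ filterᵇ p xs
  ∈-filterᵇ z∈ pz = ∈-filter⁺ {P = λ z → T (p z)} (λ z → T? (p z)) z∈ (toT pz)
  singleton : ∀ {x y} (zs : List X) → length zs ≡ 1 → x ∈ zs → y ∈ zs → x ≡ y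
  singleton (z ∷ []) _ (here refl) (here refl) = refl

-- The vector space F₂^v

⊕-comm : (x y : F2V v) → x ⊕ y ≡ y ⊕ x
⊕-comm = zipWith-comm xor-comm

⊕-assoc : (x y z : F2V v) → (x ⊕ y) ⊕ z ≡ x ⊕ (y ⊕ z)
⊕-assoc = zipWith-assoc xor-assoc

⊕-identityˡ : (x : F2V v) → zeroV v ⊕ x ≡ x
⊕-identityˡ = zipWith-identityˡ xor-identityˡ

⊕-identityʳ : (x : F2V v) → x ⊕ zeroV v ≡ x
⊕-identityʳ = zipWith-identityʳ xor-identityʳ

⊕-self : (x : F2V v) → x ⊕ x ≡ zeroV v
⊕-self [] = refl
⊕-self (a ∷ x) = cong₂ _∷_ (xor-same a) (⊕-self x)

⊕-interchange : (w x y z : F2V v) → (w ⊕ x) ⊕ (y ⊕ z) ≡ (w ⊕ y) ⊕ (x ⊕ z)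
⊕-interchange [] [] [] [] = refl
⊕-interchange (a ∷ w) (b ∷ x) (c ∷ y) (d ∷ z) = cong₂ _∷_ (interchange a b c d) (⊕-interchange w x y z)

⊕-cancelʳ : (x y : F2V v) → (x ⊕ y) ⊕ y ≡ x
⊕-cancelʳ x y = trans (⊕-assoc x y y) (trans (cong (x ⊕_) (⊕-self y)) (⊕-identityʳ x))

⊕≡0⇒≡ : {x y : F2V v} → x ⊕ y ≡ zeroV v → x ≡ y
⊕≡0⇒≡ {x = x} {y} x⊕y≡0 = trans (sym (⊕-cancelʳ x y)) (trans (cong (_⊕ y) x⊕y≡0) (⊕-identityˡ y))

eqV-refl : (x : F2V v) → eqV x x ≡ true
eqV-refl [] = refl
eqV-refl (a ∷ x) rewrite xor-same a = eqV-refl x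

eqV⇒≡ : {x y : F2V v} → eqV x y ≡ true → x ≡ y
eqV⇒≡ {x = []} {[]} _ = refl
eqV⇒≡ {x = false ∷ x} {false ∷ y} e = cong (false ∷_) (eqV⇒≡ e)
eqV⇒≡ {x = true ∷ x} {true ∷ y} e = cong (true ∷_) (eqV⇒≡ e)

≡⇒eqV : {x y : F2V v} → x ≡ y → eqV x y ≡ true
≡⇒eqV {x = x} refl = eqV-refl x

∈-allVecs : (x : F2V v) → x ∈ allVecs v
∈-allVecs [] = here refl
∈-allVecs (false ∷ x) = ∈-++⁺ˡ (∈-map⁺ (false ∷_) (∈-allVecs x))
∈-allVecs {suc v} (true ∷ x) = ∈-++⁺ʳ (map (false ∷_) (allVecs v)) (∈-map⁺ (true ∷_) (∈-allVecs x))

∑ᵥ : ∀ v → (F2V v → ℕ) → ℕ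
∑ᵥ v = ∑ (allVecs v)

∑ᵥ-suc : (f : F2V (suc v) → ℕ) →
  ∑ᵥ (suc v) f ≡ ∑ᵥ v (λ x → f (false ∷ x)) + ∑ᵥ v (λ x → f (true ∷ x))
∑ᵥ-suc {v} f = trans (∑-++ (map (false ∷_) (allVecs v)) _ f)
  (cong₂ _+_ (∑-map (false ∷_) (allVecs v) f) (∑-map (true ∷_) (allVecs v) f))

∑ᵥ-delta : (y : F2V v) (g : F2V v → ℕ) → ∑ᵥ v (λ x → ⟦ eqV x y ⟧ * g x) ≡ g y
∑ᵥ-delta [] g = trans (+-identityʳ _) (+-identityʳ (g []))
∑ᵥ-delta {suc v} (false ∷ y) g = begin
  ∑ᵥ (suc v) (λ x → ⟦ eqV x (false ∷ y) ⟧ * g x)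
    ≡⟨ ∑ᵥ-suc {v} _ ⟩
  ∑ᵥ v (λ x → ⟦ eqV x y ⟧ * g (false ∷ x)) + ∑ᵥ v (λ _ → 0)
    ≡⟨ cong₂ _+_ (∑ᵥ-delta y _) (∑-zero (allVecs v)) ⟩
  g (false ∷ y) + 0
    ≡⟨ +-identityʳ _ ⟩
  g (false ∷ y) ∎
  where open ≡-Reasoning
∑ᵥ-delta {suc v} (true ∷ y) g =
  trans (∑ᵥ-suc {v} _) (trans (cong (_+ ∑ᵥ v (λ x → ⟦ eqV x y ⟧ * g (true ∷ x))) (∑-zero (allVecs v)))
    (∑ᵥ-delta y (λ x → g (true ∷ x))))

∑ᵥ-inverse : (f : F2V v → ℕ) (g h : F2V v → F2V v) → (∀ x → h (g x) ≡ x) → (∀ y → g (h y) ≡ y) →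
  ∑ᵥ v (λ x → f (g x)) ≡ ∑ᵥ v f
∑ᵥ-inverse {v} f g h hg gh = begin
  ∑ᵥ v (λ x → f (g x))
    ≡⟨ ∑-cong (allVecs v) (λ x → sym (∑ᵥ-delta (g x) f)) ⟩
  ∑ᵥ v (λ x → ∑ᵥ v (λ y → ⟦ eqV y (g x) ⟧ * f y))
    ≡⟨ ∑-comm (allVecs v) (allVecs v) _ ⟩
  ∑ᵥ v (λ y → ∑ᵥ v (λ x → ⟦ eqV y (g x) ⟧ * f y))
    ≡⟨ ∑-cong (allVecs v) (λ y → ∑-cong (allVecs v) (λ x → cong (λ b → ⟦ b ⟧ * f y) (eqV-transpose x y))) ⟩
  ∑ᵥ v (λ y → ∑ᵥ v (λ x → ⟦ eqV x (h y) ⟧ * f y))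
    ≡⟨ ∑-cong (allVecs v) (λ y → ∑ᵥ-delta (h y) (λ _ → f y)) ⟩
  ∑ᵥ v f ∎
  where
  open ≡-Reasoning
  eqV-transpose : ∀ x y → eqV y (g x) ≡ eqV x (h y)
  eqV-transpose x y = ⇔→≡ (mk⇔
    (λ e → ≡⇒eqV (trans (sym (hg x)) (cong h (sym (eqV⇒≡ e)))))
    (λ e → ≡⇒eqV (trans (sym (gh y)) (cong g (sym (eqV⇒≡ e))))))

count : (F2V v → Bool) → ℕ
count {v} P = ∑ᵥ v (λ x → ⟦ P x ⟧)

card≡count : (S : VSet v) → card S ≡ count S
card≡count {v} S = length-filterᵇ S (allVecs v)

count-cong : {P Q : F2V v → Bool} → (∀ x → P x ≡ Q x) → count P ≡ count Q
count-cong {v} P≗Q = ∑-cong (allVecs v) (λ x → cong ⟦_⟧ (P≗Q x))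

count-mono : {P Q : F2V v → Bool} → (∀ x → P x ≡ true → Q x ≡ true) → count P ≤ count Q
count-mono {v} {P} {Q} P⊆Q = ∑-mono-≤ (allVecs v) ⟦P⟧≤⟦Q⟧
  where
  ⟦P⟧≤⟦Q⟧ : ∀ x → ⟦ P x ⟧ ≤ ⟦ Q x ⟧
  ⟦P⟧≤⟦Q⟧ x with P x in Px
  ... | false = z≤n
  ... | true rewrite P⊆Q x Px = ≤-refl

count-witness : (P : F2V v → Bool) → 0 < count P → ∃ λ x → P x ≡ true
count-witness {v} = ∑⟦⟧-witness (allVecs v)

count-split : (P Q : F2V v → Bool) → count P ≡ count (λ x → P x ∧ Q x) + count (λ x → P x ∧ not (Q x))
count-split {v} P Q = trans (∑-cong (allVecs v) (λ x → ⟦⟧-split (P x) (Q x))) (∑-distrib-+ (allVecs v) _ _)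

count-inverse : (P : F2V v → Bool) (g h : F2V v → F2V v) → (∀ x → h (g x) ≡ x) → (∀ y → g (h y) ≡ y) →
  count (λ x → P (g x)) ≡ count P
count-inverse P = ∑ᵥ-inverse (λ x → ⟦ P x ⟧)

count-eqV : (y : F2V v) → count (λ x → eqV x y) ≡ 1
count-eqV {v} y = trans (∑-cong (allVecs v) (λ x → sym (*-identityʳ ⟦ eqV x y ⟧))) (∑ᵥ-delta y (λ _ → 1))

count-true : ∀ v → count {v} (λ _ → true) ≡ 2 ^ v
count-true zero = refl
count-true (suc v) = trans (∑ᵥ-suc {v} _) (cong₂ _+_ (count-true v) (trans (count-true v) (sym (+-identityʳ _))))

count-eqV∧ : (c : F2V v) (P : F2V v → Bool) → count (λ y → eqV y c ∧ P y) ≡ ⟦ P c ⟧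
count-eqV∧ {v} c P = trans (∑-cong (allVecs v) (λ y → ⟦∧⟧ (eqV y c) (P y))) (∑ᵥ-delta c (λ y → ⟦ P y ⟧))

count-distinct-pairs : (P : F2V v → Bool) →
  ∑ᵥ v (λ x → count (λ y → P x ∧ (P y ∧ not (eqV y x)))) ≡ count P * (count P ∸ 1)
count-distinct-pairs {v} P =
  trans (∑-cong (allVecs v) partners)
    (trans (∑-*ˡ (allVecs v) (count P ∸ 1) _) (*-comm (count P ∸ 1) (count P)))
  where
  partners : ∀ x → count (λ y → P x ∧ (P y ∧ not (eqV y x))) ≡ (count P ∸ 1) * ⟦ P x ⟧
  partners x with P x in Px
  ... | false = trans (∑-zero (allVecs v)) (sym (*-zeroʳ (count P ∸ 1)))
  ... | true = begin
    others                                         ≡⟨ m+n∸m≡n 1 others ⟨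
    1 + others ∸ 1                                 ≡⟨ cong (λ n → n + others ∸ 1) x-only ⟨
    count (λ y → P y ∧ eqV y x) + others ∸ 1       ≡⟨ cong (_∸ 1) (count-split P (λ y → eqV y x)) ⟨
    count P ∸ 1                                    ≡⟨ *-identityʳ _ ⟨
    (count P ∸ 1) * 1                              ∎
    where
    open ≡-Reasoning
    others : ℕ
    others = count (λ y → P y ∧ not (eqV y x))
    x-only : count (λ y → P y ∧ eqV y x) ≡ 1
    x-only = trans (count-cong (λ y → ∧-comm (P y) (eqV y x)))
      (trans (count-eqV∧ x P) (cong ⟦_⟧ Px))

count-none : (P : F2V v → Bool) → (∀ x → P x ≡ true → ⊥) → count P ≡ 0
count-none {v} P never = trans (count-cong false-everywhere) (∑-zero (allVecs v))
  where
  false-everywhere : ∀ x → P x ≡ false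
  false-everywhere x with P x in Px
  ... | false = refl
  ... | true = ⊥-elim (never x Px)

-- Matrices and the involution A_{v,s}

scale : Bool → Vec Bool n → Vec Bool n
scale {n} a r = if a then r else zeroV n

scale-xor : ∀ a b (r : Vec Bool n) → scale (a xor b) r ≡ scale a r ⊕ scale b r
scale-xor false b r = sym (⊕-identityˡ _)
scale-xor true false r = sym (⊕-identityʳ r)
scale-xor true true r = sym (⊕-self r)

vecMat-zeroV : (M : Vec (Vec Bool n) m) → vecMat (zeroV m) M ≡ zeroV n
vecMat-zeroV [] = refl
vecMat-zeroV (r ∷ M) = trans (⊕-identityˡ _) (vecMat-zeroV M)

vecMat-⊕ : (x y : Vec Bool m) (M : Vec (Vec Bool n) m) → vecMat (x ⊕ y) M ≡ vecMat x M ⊕ vecMat y M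
vecMat-⊕ [] [] [] = sym (⊕-self _)
vecMat-⊕ (a ∷ x) (b ∷ y) (r ∷ M) =
  trans (cong₂ _⊕_ (scale-xor a b r) (vecMat-⊕ x y M)) (⊕-interchange _ _ _ _)

vecMat-scale : ∀ a (x : Vec Bool m) (M : Vec (Vec Bool n) m) → vecMat (scale a x) M ≡ scale a (vecMat x M)
vecMat-scale false x M = vecMat-zeroV M
vecMat-scale true x M = refl

vecMat-assoc : ∀ {k} (x : Vec Bool m) (M : Vec (Vec Bool n) m) (N : Vec (Vec Bool k) n) →
  vecMat x (Vec.map (λ r → vecMat r N) M) ≡ vecMat (vecMat x M) N
vecMat-assoc [] [] N = sym (vecMat-zeroV N)
vecMat-assoc (a ∷ x) (r ∷ M) N = begin
  scale a (vecMat r N) ⊕ vecMat x (Vec.map (λ r → vecMat r N) M)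
    ≡⟨ cong₂ _⊕_ (sym (vecMat-scale a r N)) (vecMat-assoc x M N) ⟩
  vecMat (scale a r) N ⊕ vecMat (vecMat x M) N
    ≡⟨ vecMat-⊕ (scale a r) (vecMat x M) N ⟨
  vecMat (scale a r ⊕ vecMat x M) N ∎
  where open ≡-Reasoning

vecMat-map-false∷ : (x : Vec Bool m) (M : Vec (Vec Bool n) m) →
  vecMat x (Vec.map (false ∷_) M) ≡ false ∷ vecMat x M
vecMat-map-false∷ [] [] = refl
vecMat-map-false∷ (a ∷ x) (r ∷ M) = trans (cong (scale a (false ∷ r) ⊕_) (vecMat-map-false∷ x M)) (head a)
  where
  head : ∀ a → scale a (false ∷ r) ⊕ (false ∷ vecMat x M) ≡ false ∷ (scale a r ⊕ vecMat x M)
  head false = refl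
  head true = refl

tabulate-false : ∀ n → tabulate {n = n} (λ _ → false) ≡ zeroV n
tabulate-false zero = refl
tabulate-false (suc n) = cong (false ∷_) (tabulate-false n)

idMat-suc : ∀ v → idMat (suc v) ≡ (true ∷ zeroV v) ∷ Vec.map (false ∷_) (idMat v)
idMat-suc v = cong₂ _∷_ (cong (true ∷_) (tabulate-false v)) (tabulate-∘ (false ∷_) _)

vecMat-idMat : (x : F2V v) → vecMat x (idMat v) ≡ x
vecMat-idMat [] = refl
vecMat-idMat {suc v} (a ∷ x) = begin
  vecMat (a ∷ x) (idMat (suc v))
    ≡⟨ cong (vecMat (a ∷ x)) (idMat-suc v) ⟩
  scale a (true ∷ zeroV v) ⊕ vecMat x (Vec.map (false ∷_) (idMat v))
    ≡⟨ cong (scale a (true ∷ zeroV v) ⊕_) (trans (vecMat-map-false∷ x (idMat v)) (cong (false ∷_) (vecMat-idMat x))) ⟩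
  scale a (true ∷ zeroV v) ⊕ (false ∷ x)
    ≡⟨ head a ⟩
  a ∷ x ∎
  where
  open ≡-Reasoning
  head : ∀ a → scale a (true ∷ zeroV v) ⊕ (false ∷ x) ≡ a ∷ x
  head false = cong (false ∷_) (⊕-identityˡ x)
  head true = cong (true ∷_) (⊕-identityˡ x)

vecMat-inverse : {P Q : Mat v} → P · Q ≡ idMat v → (x : F2V v) → vecMat (vecMat x P) Q ≡ x
vecMat-inverse {P = P} {Q} PQ≡I x = trans (sym (vecMat-assoc x P Q)) (trans (cong (vecMat x) PQ≡I) (vecMat-idMat x))

half-suc² : ∀ a → suc (suc a) / 2 ≡ suc (a / 2)
half-suc² a = m/n≡1+[m∸n]/n {suc (suc a)} {2} (s≤s (s≤s z≤n))

-- Avs v s is pairMatrix v (2 * s) by definition; a free threshold t lets induction peel off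
-- one 2 × 2 block at a time.
pairEntry : ℕ → ℕ → ℕ → Bool
pairEntry t a b = if a <ᵇ t then ((a / 2) ≡ᵇ (b / 2)) ∧ not (a ≡ᵇ b) else (a ≡ᵇ b)

pairMatrix : ∀ v → ℕ → Mat v
pairMatrix v t = tabulate λ i → tabulate λ j → pairEntry t (toℕ i) (toℕ j)

pairEntry-suc² : ∀ t a b → pairEntry (2 + t) (2 + a) (2 + b) ≡ pairEntry t a b
pairEntry-suc² t a b rewrite half-suc² a | half-suc² b = refl

pairEntry-0-suc² : ∀ t b → pairEntry (2 + t) 0 (2 + b) ≡ false
pairEntry-0-suc² t b rewrite half-suc² b = refl

pairEntry-1-suc² : ∀ t b → pairEntry (2 + t) 1 (2 + b) ≡ false
pairEntry-1-suc² t b rewrite half-suc² b = refl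

pairEntry-suc²-0 : ∀ t a → pairEntry (2 + t) (2 + a) 0 ≡ false
pairEntry-suc²-0 t a rewrite half-suc² a with a <ᵇ t
... | true = refl
... | false = refl

pairEntry-suc²-1 : ∀ t a → pairEntry (2 + t) (2 + a) 1 ≡ false
pairEntry-suc²-1 t a rewrite half-suc² a with a <ᵇ t
... | true = refl
... | false = refl

pairMatrix-suc² : ∀ v t → pairMatrix (2 + v) (2 + t) ≡
  (false ∷ true ∷ zeroV v) ∷ (true ∷ false ∷ zeroV v) ∷ Vec.map (false ∷_) (Vec.map (false ∷_) (pairMatrix v t))
pairMatrix-suc² v t =
  cong₂ _∷_ (cong (λ r → false ∷ true ∷ r) (zero-row (pairEntry (2 + t) 0) (pairEntry-0-suc² t)))
  (cong₂ _∷_ (cong (λ r → true ∷ false ∷ r) (zero-row (pairEntry (2 + t) 1) (pairEntry-1-suc² t)))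
    (trans (tabulate-cong lower-rows)
      (trans (tabulate-∘ (false ∷_) _) (cong (Vec.map (false ∷_)) (tabulate-∘ (false ∷_) _)))))
  where
  zero-row : (f : ℕ → Bool) → (∀ b → f (2 + b) ≡ false) → tabulate {n = v} (λ j → f (2 + toℕ j)) ≡ zeroV v
  zero-row f f≡false = trans (tabulate-cong (λ j → f≡false (toℕ j))) (tabulate-false v)
  lower-rows : ∀ i → tabulate (λ j → pairEntry (2 + t) (2 + toℕ i) (toℕ j))
                   ≡ false ∷ false ∷ tabulate (λ j → pairEntry t (toℕ i) (toℕ j))
  lower-rows i = cong₂ _∷_ (pairEntry-suc²-0 t (toℕ i)) (cong₂ _∷_ (pairEntry-suc²-1 t (toℕ i))
    (tabulate-cong (λ j → pairEntry-suc² t (toℕ i) (toℕ j))))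

vecMat-pairMatrix-suc² : ∀ t a b (x : F2V v) →
  vecMat (a ∷ b ∷ x) (pairMatrix (2 + v) (2 + t)) ≡ b ∷ a ∷ vecMat x (pairMatrix v t)
vecMat-pairMatrix-suc² {v} t a b x = begin
  vecMat (a ∷ b ∷ x) (pairMatrix (2 + v) (2 + t))
    ≡⟨ cong (vecMat (a ∷ b ∷ x)) (pairMatrix-suc² v t) ⟩
  row₀ a ⊕ (row₁ b ⊕ vecMat x (Vec.map (false ∷_) (Vec.map (false ∷_) M)))
    ≡⟨ cong (λ y → row₀ a ⊕ (row₁ b ⊕ y))
         (trans (vecMat-map-false∷ x _) (cong (false ∷_) (vecMat-map-false∷ x M))) ⟩
  row₀ a ⊕ (row₁ b ⊕ (false ∷ false ∷ vecMat x M))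
    ≡⟨ swap-head a b ⟩
  b ∷ a ∷ vecMat x M ∎
  where
  open ≡-Reasoning
  M : Mat v
  M = pairMatrix v t
  row₀ row₁ : Bool → F2V (2 + v)
  row₀ a = scale a (false ∷ true ∷ zeroV v)
  row₁ b = scale b (true ∷ false ∷ zeroV v)
  tail : zeroV v ⊕ (zeroV v ⊕ vecMat x M) ≡ vecMat x M
  tail = trans (⊕-identityˡ _) (⊕-identityˡ _)
  swap-head : ∀ a b → row₀ a ⊕ (row₁ b ⊕ (false ∷ false ∷ vecMat x M)) ≡ b ∷ a ∷ vecMat x M
  swap-head false false = cong (λ y → false ∷ false ∷ y) tail
  swap-head false true = cong (λ y → true ∷ false ∷ y) tail
  swap-head true false = cong (λ y → false ∷ true ∷ y) tail
  swap-head true true = cong (λ y → true ∷ true ∷ y) tail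

swapPairs : ℕ → F2V v → F2V v
swapPairs zero x = x
swapPairs (suc s) (a ∷ b ∷ x) = b ∷ a ∷ swapPairs s x
swapPairs (suc s) x = x

2*suc≤⇒2*≤ : ∀ {s v} → 2 * suc s ≤ 2 + v → 2 * s ≤ v
2*suc≤⇒2*≤ {s} {v} le = +-cancelˡ-≤ 2 _ _ (subst (_≤ 2 + v) (*-suc 2 s) le)

vecMat-Avs : ∀ v s → 2 * s ≤ v → (x : F2V v) → vecMat x (Avs v s) ≡ swapPairs s x
vecMat-Avs v zero _ x = vecMat-idMat x
vecMat-Avs (suc (suc v)) (suc s) le (a ∷ b ∷ x) = begin
  vecMat (a ∷ b ∷ x) (pairMatrix (2 + v) (2 * suc s))
    ≡⟨ cong (λ t → vecMat (a ∷ b ∷ x) (pairMatrix (2 + v) t)) (*-suc 2 s) ⟩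
  vecMat (a ∷ b ∷ x) (pairMatrix (2 + v) (2 + 2 * s))
    ≡⟨ vecMat-pairMatrix-suc² (2 * s) a b x ⟩
  b ∷ a ∷ vecMat x (Avs v s)
    ≡⟨ cong (λ y → b ∷ a ∷ y) (vecMat-Avs v s (2*suc≤⇒2*≤ le) x) ⟩
  b ∷ a ∷ swapPairs s x ∎
  where open ≡-Reasoning
vecMat-Avs 0 (suc s) le x with () ← subst (_≤ 0) (*-suc 2 s) le
vecMat-Avs 1 (suc s) le x with s≤s () ← subst (_≤ 1) (*-suc 2 s) le

count-swapPairs-fixed : ∀ v s → 2 * s ≤ v → count {v} (λ x → eqV (swapPairs s x) x) ≡ 2 ^ (v ∸ s)
count-swapPairs-fixed v zero _ = trans (count-cong {v} eqV-refl) (count-true v)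
count-swapPairs-fixed (suc (suc v)) (suc s) le = begin
  count {2 + v} (λ x → eqV (swapPairs (suc s) x) x)
    ≡⟨ ∑ᵥ-suc {suc v} _ ⟩
  ∑ᵥ (suc v) (λ x → ⟦ eqV (swapPairs (suc s) (false ∷ x)) (false ∷ x) ⟧)
    + ∑ᵥ (suc v) (λ x → ⟦ eqV (swapPairs (suc s) (true ∷ x)) (true ∷ x) ⟧)
    ≡⟨ cong₂ _+_ (∑ᵥ-suc {v} _) (∑ᵥ-suc {v} _) ⟩
  (c + ∑ᵥ v (λ _ → 0)) + (∑ᵥ v (λ _ → 0) + c)
    ≡⟨ cong₂ (λ z z′ → (c + z) + (z′ + c)) (∑-zero (allVecs v)) (∑-zero (allVecs v)) ⟩
  (c + 0) + c                                   ≡⟨ cong (_+ c) (+-identityʳ c) ⟩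
  c + c                                         ≡⟨ cong (λ z → c + z) (+-identityʳ c) ⟨
  2 * c                                         ≡⟨ cong (2 *_) (count-swapPairs-fixed v s s≤v) ⟩
  2 ^ suc (v ∸ s)                               ≡⟨ cong (2 ^_) (+-∸-assoc 1 (≤-trans (m≤n*m s 2) s≤v)) ⟨
  2 ^ (suc (suc v) ∸ suc s)                     ∎
  where
  open ≡-Reasoning
  c : ℕ
  c = count {v} (λ x → eqV (swapPairs s x) x)
  s≤v : 2 * s ≤ v
  s≤v = 2*suc≤⇒2*≤ le
count-swapPairs-fixed 0 (suc s) le with () ← subst (_≤ 0) (*-suc 2 s) le
count-swapPairs-fixed 1 (suc s) le with s≤s () ← subst (_≤ 1) (*-suc 2 s) le

fixedVecᵇ : Mat v → F2V v → Bool
fixedVecᵇ A x = eqV (vecMat x A) x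

count-fixedVec-conj : {A M P Q : Mat v} → P · Q ≡ idMat v → Q · P ≡ idMat v → A ≡ (Q · M) · P →
  count (fixedVecᵇ A) ≡ count (fixedVecᵇ M)
count-fixedVec-conj {v} {A} {M} {P} {Q} PQ≡I QP≡I A≡QMP =
  trans (count-cong {v} fixed⇔fixed-Q) (count-inverse (fixedVecᵇ M) (λ x → vecMat x Q) (λ y → vecMat y P)
    (vecMat-inverse QP≡I) (vecMat-inverse PQ≡I))
  where
  xA≡xQMP : ∀ x → vecMat x A ≡ vecMat (vecMat (vecMat x Q) M) P
  xA≡xQMP x = trans (cong (vecMat x) A≡QMP)
    (trans (vecMat-assoc x (Q · M) P) (cong (λ y → vecMat y P) (vecMat-assoc x Q M)))
  fixed⇔fixed-Q : ∀ x → fixedVecᵇ A x ≡ fixedVecᵇ M (vecMat x Q)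
  fixed⇔fixed-Q x = ⇔→≡ (mk⇔
    (λ e → ≡⇒eqV (trans (sym (vecMat-inverse PQ≡I (vecMat (vecMat x Q) M)))
                   (cong (λ y → vecMat y Q) (trans (sym (xA≡xQMP x)) (eqV⇒≡ {x = vecMat x A} e)))))
    (λ e → ≡⇒eqV (trans (xA≡xQMP x)
                   (trans (cong (λ y → vecMat y P) (eqV⇒≡ {x = vecMat (vecMat x Q) M} e)) (vecMat-inverse QP≡I x)))))

count-fixedVec-Avs : ∀ v s → 2 * s ≤ v → count (fixedVecᵇ (Avs v s)) ≡ 2 ^ (v ∸ s)
count-fixedVec-Avs v s le =
  trans (count-cong {v} (λ x → cong (λ y → eqV y x) (vecMat-Avs v s le x))) (count-swapPairs-fixed v s le)

·-identityʳ : (M : Mat v) → M · idMat v ≡ M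
·-identityʳ M = trans (map-cong vecMat-idMat M) (map-id M)

conjugate-idMat : {A : Mat v} → Conjugate A (idMat v) → A ≡ idMat v
conjugate-idMat {v} (P , Q , _ , QP≡I , A≡QIP) = trans A≡QIP (trans (cong (_· P) (·-identityʳ Q)) QP≡I)

conjugate-Avs⇒1≤s : ∀ v s {A : Mat v} → A ≢ idMat v → Conjugate A (Avs v s) → 1 ≤ s
conjugate-Avs⇒1≤s v zero A≢I A~I = contradiction (conjugate-idMat A~I) A≢I
conjugate-Avs⇒1≤s v (suc s) _ _ = s≤s z≤n

-- Subsets and planes

all-allVecs⁻ : (p : F2V v → Bool) → all p (allVecs v) ≡ true → ∀ x → p x ≡ true
all-allVecs⁻ {v} p all≡true x = fromT (All.lookup (all⁺ p (allVecs v) (toT all≡true)) (∈-allVecs x))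

all-allVecs⁺ : (p : F2V v → Bool) → (∀ x → p x ≡ true) → all p (allVecs v) ≡ true
all-allVecs⁺ {v} p p≡true = fromT (all⁻ p {xs = allVecs v} (All.tabulate (λ {x} _ → toT (p≡true x))))

any-allVecs⁺ : (p : F2V v → Bool) (x : F2V v) → p x ≡ true → any p (allVecs v) ≡ true
any-allVecs⁺ p x px = fromT (any⁺ p (Any.map (λ { refl → toT px }) (∈-allVecs x)))

fixedᵇ⇒≐ : ∀ {v} (A : Mat v) (B : VSet v) → fixedᵇ A B ≡ true → image A B ≐ B
fixedᵇ⇒≐ A B B-fixed x = not-xor≡true⇒≡ (all-allVecs⁻ _ B-fixed x)
  where
  not-xor≡true⇒≡ : ∀ {a b} → not (a xor b) ≡ true → a ≡ b
  not-xor≡true⇒≡ {false} {false} _ = refl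
  not-xor≡true⇒≡ {true} {true} _ = refl

≐⇒fixedᵇ : ∀ {v} (A : Mat v) (B : VSet v) → image A B ≐ B → fixedᵇ A B ≡ true
≐⇒fixedᵇ A B AB≐B =
  all-allVecs⁺ _ (λ x → subst (λ b → not (b xor B x) ≡ true) (sym (AB≐B x)) (not-xor-same (B x)))
  where
  not-xor-same : ∀ a → not (a xor a) ≡ true
  not-xor-same false = refl
  not-xor-same true = refl

_∈ᵇ_ : F2V v → List (F2V v) → Bool
z ∈ᵇ ps = any (eqV z) ps

∈ᵇ⇒∈ : {z : F2V v} (ps : List (F2V v)) → z ∈ᵇ ps ≡ true → z ∈ ps
∈ᵇ⇒∈ {z = z} ps z∈ᵇps = Any.map (λ e → eqV⇒≡ {x = z} (fromT e)) (any⁻ (eqV z) ps (toT z∈ᵇps))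

∈⇒∈ᵇ : {z : F2V v} {ps : List (F2V v)} → z ∈ ps → z ∈ᵇ ps ≡ true
∈⇒∈ᵇ {z = z} z∈ps = fromT (any⁺ (eqV z) (Any.map (λ { refl → toT (eqV-refl z) }) z∈ps))

count-∈ᵇ : (ps : List (F2V v)) → Unique ps → count (_∈ᵇ ps) ≡ length ps
count-∈ᵇ {v} [] [] = ∑-zero (allVecs v)
count-∈ᵇ {v} (p ∷ ps) (p∉ps ∷ unique) = begin
  count (_∈ᵇ (p ∷ ps))                          ≡⟨ ∑-cong (allVecs v) split ⟩
  ∑ᵥ v (λ z → ⟦ eqV z p ⟧ + ⟦ z ∈ᵇ ps ⟧)          ≡⟨ ∑-distrib-+ (allVecs v) _ _ ⟩
  count (λ z → eqV z p) + count (_∈ᵇ ps)         ≡⟨ cong₂ _+_ (count-eqV p) (count-∈ᵇ ps unique) ⟩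
  suc (length ps)                               ∎
  where
  open ≡-Reasoning
  split : ∀ z → ⟦ eqV z p ∨ z ∈ᵇ ps ⟧ ≡ ⟦ eqV z p ⟧ + ⟦ z ∈ᵇ ps ⟧
  split z with eqV z p in z≡p | z ∈ᵇ ps in z∈ps
  ... | true | true = ⊥-elim (All¬⇒¬Any p∉ps (subst (_∈ ps) (eqV⇒≡ {x = z} z≡p) (∈ᵇ⇒∈ ps z∈ps)))
  ... | true | false = refl
  ... | false | _ = refl

lin : F2V v → F2V v → Bool → Bool → F2V v
lin x y a b = scale a x ⊕ scale b y

lin-⊕ : (x y : F2V v) (a b c d : Bool) → lin x y a b ⊕ lin x y c d ≡ lin x y (a xor c) (b xor d)
lin-⊕ x y a b c d = trans (⊕-interchange (scale a x) (scale b y) (scale c x) (scale d y))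
  (sym (cong₂ _⊕_ (scale-xor a c x) (scale-xor b d y)))

Independent : F2V v → F2V v → Set
Independent {v} x y = x ≢ zeroV v × y ≢ zeroV v × x ≢ y

lin≡0 : {x y : F2V v} → Independent x y → ∀ a b → lin x y a b ≡ zeroV v → a ≡ false × b ≡ false
lin≡0 _ false false _ = refl , refl
lin≡0 {y = y} (_ , y≢0 , _) false true y≡0 = ⊥-elim (y≢0 (trans (sym (⊕-identityˡ y)) y≡0))
lin≡0 {x = x} (x≢0 , _ , _) true false x≡0 = ⊥-elim (x≢0 (trans (sym (⊕-identityʳ x)) x≡0))
lin≡0 (_ , _ , x≢y) true true x⊕y≡0 = ⊥-elim (x≢y (⊕≡0⇒≡ x⊕y≡0))

lin-injective : {x y : F2V v} → Independent x y → ∀ {a b c d} → lin x y a b ≡ lin x y c d → a ≡ c × b ≡ d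
lin-injective {x = x} {y} ind {a} {b} {c} {d} eq with lin≡0 ind (a xor c) (b xor d)
  (trans (sym (lin-⊕ x y a b c d)) (trans (cong (_⊕ lin x y c d) eq) (⊕-self _)))
... | a⊕c≡0 , b⊕d≡0 = xor≡false⇒≡ a c a⊕c≡0 , xor≡false⇒≡ b d b⊕d≡0
  where
  xor≡false⇒≡ : ∀ p q → p xor q ≡ false → p ≡ q
  xor≡false⇒≡ false false _ = refl
  xor≡false⇒≡ true true _ = refl

spanList : F2V v → F2V v → List (F2V v)
spanList x y = lin x y false false ∷ lin x y false true ∷ lin x y true false ∷ lin x y true true ∷ []

span : F2V v → F2V v → VSet v
span x y z = z ∈ᵇ spanList x y

spanList-unique : {x y : F2V v} → Independent x y → Unique (spanList x y)
spanList-unique ind =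
  (≢ (λ _ ()) ∷ ≢ (λ ()) ∷ ≢ (λ ()) ∷ []) ∷
  (≢ (λ ()) ∷ ≢ (λ ()) ∷ []) ∷
  (≢ (λ _ ()) ∷ []) ∷ [] ∷ []
  where
  ≢ : ∀ {a b c d} → (a ≡ c → b ≡ d → ⊥) → lin _ _ a b ≢ lin _ _ c d
  ≢ different eq with lin-injective ind eq
  ... | a≡c , b≡d = different a≡c b≡d

count-span : {x y : F2V v} → Independent x y → count (span x y) ≡ 4
count-span {x = x} {y} ind = count-∈ᵇ (spanList x y) (spanList-unique ind)

lin∈span : (x y : F2V v) (a b : Bool) → span x y (lin x y a b) ≡ true
lin∈span x y false false = ∈⇒∈ᵇ {ps = spanList x y} (here refl)
lin∈span x y false true = ∈⇒∈ᵇ {ps = spanList x y} (there (here refl))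
lin∈span x y true false = ∈⇒∈ᵇ {ps = spanList x y} (there (there (here refl)))
lin∈span x y true true = ∈⇒∈ᵇ {ps = spanList x y} (there (there (there (here refl))))

span⇒lin : (x y z : F2V v) → span x y z ≡ true → ∃₂ λ a b → z ≡ lin x y a b
span⇒lin x y z z∈span with ∈ᵇ⇒∈ {z = z} (spanList x y) z∈span
... | here refl = false , false , refl
... | there (here refl) = false , true , refl
... | there (there (here refl)) = true , false , refl
... | there (there (there (here refl))) = true , true , refl

lin∈subspace : {B : VSet v} → IsSubspace B → ∀ {x y} → B x ≡ true → B y ≡ true →
  ∀ a b → B (lin x y a b) ≡ true
lin∈subspace {B = B} (0∈B , _) {x} {y} _ _ false false = subst (λ z → B z ≡ true) (sym (⊕-identityˡ _)) 0∈B
lin∈subspace {B = B} _ {x} {y} _ y∈B false true = subst (λ z → B z ≡ true) (sym (⊕-identityˡ y)) y∈B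
lin∈subspace {B = B} _ {x} {y} x∈B _ true false = subst (λ z → B z ≡ true) (sym (⊕-identityʳ x)) x∈B
lin∈subspace (_ , ⊕-closed) x∈B y∈B true true = ⊕-closed _ _ x∈B y∈B

span⊆subspace : {B : VSet v} → IsSubspace B → ∀ {x y} → B x ≡ true → B y ≡ true →
  ∀ z → span x y z ≡ true → B z ≡ true
span⊆subspace {B = B} B-sub {x} {y} x∈B y∈B z z∈span with span⇒lin x y z z∈span
... | a , b , refl = lin∈subspace B-sub x∈B y∈B a b

span-isSubspace : (x y : F2V v) → IsSubspace (span x y)
span-isSubspace {v} x y =
  subst (λ z → span x y z ≡ true) (⊕-identityˡ _) (lin∈span x y false false) , ⊕-closed
  where
  ⊕-closed : ∀ z w → span x y z ≡ true → span x y w ≡ true → span x y (z ⊕ w) ≡ true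
  ⊕-closed z w z∈span w∈span with span⇒lin x y z z∈span | span⇒lin x y w w∈span
  ... | a , b , refl | c , d , refl =
    subst (λ u → span x y u ≡ true) (sym (lin-⊕ x y a b c d)) (lin∈span x y (a xor c) (b xor d))

x∈span : (x y : F2V v) → span x y x ≡ true
x∈span x y = subst (λ z → span x y z ≡ true) (⊕-identityʳ x) (lin∈span x y true false)

y∈span : (x y : F2V v) → span x y y ≡ true
y∈span x y = subst (λ z → span x y z ≡ true) (⊕-identityˡ y) (lin∈span x y false true)

span⊆ᵇ≡∧ : {B : VSet v} → IsSubspace B → (x y : F2V v) → (span x y ⊆ᵇ B) ≡ (B x ∧ B y)
span⊆ᵇ≡∧ {B = B} B-sub x y = ⇔→≡ (mk⇔ ⊆⇒∈ ∈⇒⊆)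
  where
  member : ∀ {z} → (span x y ⊆ᵇ B) ≡ true → span x y z ≡ true → B z ≡ true
  member {z} span⊆B z∈span = subst (λ b → not b ∨ B z ≡ true) z∈span (all-allVecs⁻ _ span⊆B z)
  ⊆⇒∈ : (span x y ⊆ᵇ B) ≡ true → (B x ∧ B y) ≡ true
  ⊆⇒∈ span⊆B = cong₂ _∧_ (member span⊆B (x∈span x y)) (member span⊆B (y∈span x y))
  ∈⇒⊆ : (B x ∧ B y) ≡ true → (span x y ⊆ᵇ B) ≡ true
  ∈⇒⊆ x∧y∈B = all-allVecs⁺ _ in-B
    where
    in-B : ∀ z → not (span x y z) ∨ B z ≡ true
    in-B z with span x y z in z∈span
    ... | false = refl
    ... | true = span⊆subspace B-sub (∧-conicalˡ _ _ x∧y∈B) (∧-conicalʳ _ _ x∧y∈B) z z∈span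

-- Arithmetic

2^≡1+pred : ∀ m → 2 ^ m ≡ suc (pred (2 ^ m))
2^≡1+pred m = sym (suc-pred (2 ^ m) {{m^n≢0 2 m}})

2^[2*[2+m]∸1] : ∀ m → 2 ^ (2 * (2 + m) ∸ 1) ≡ 8 * (2 ^ m * 2 ^ m)
2^[2*[2+m]∸1] m = begin
  2 ^ (2 * (2 + m) ∸ 1)   ≡⟨ cong (2 ^_) exponent ⟩
  2 ^ (3 + (m + m))       ≡⟨ 2*[2*[2*x]]≡8*x (2 ^ (m + m)) ⟩
  8 * 2 ^ (m + m)         ≡⟨ cong (8 *_) (^-distribˡ-+-* 2 m m) ⟩
  8 * (2 ^ m * 2 ^ m)     ∎
  where
  open ≡-Reasoning
  double : ∀ n → 2 * (2 + n) ≡ 4 + (n + n)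
  double = solve-∀
  exponent : 2 * (2 + m) ∸ 1 ≡ 3 + (m + m)
  exponent = cong (_∸ 1) (double m)
  2*[2*[2*x]]≡8*x : ∀ x → 2 * (2 * (2 * x)) ≡ 8 * x
  2*[2*[2*x]]≡8*x x = sym (trans (*-assoc 4 2 x) (*-assoc 2 2 (2 * x)))

F₃-closed-form : ∀ m s F₃ → 2 ^ (2 + m + s) ≡ 2 ^ (2 + m) + 4 * F₃ → F₃ ≡ 2 ^ m * (2 ^ s ∸ 1)
F₃-closed-form m s F₃ all≡fixed+moved = begin
  F₃                   ≡⟨ m+n∸m≡n P F₃ ⟨
  P + F₃ ∸ P           ≡⟨ cong (_∸ P) P*S≡P+F₃ ⟨
  P * 2 ^ s ∸ P        ≡⟨ cong (P * 2 ^ s ∸_) (*-identityʳ P) ⟨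
  P * 2 ^ s ∸ P * 1    ≡⟨ *-distribˡ-∸ P (2 ^ s) 1 ⟨
  P * (2 ^ s ∸ 1)      ∎
  where
  open ≡-Reasoning
  P : ℕ
  P = 2 ^ m
  P*S≡P+F₃ : P * 2 ^ s ≡ P + F₃
  P*S≡P+F₃ = *-cancelˡ-≡ _ _ 4 (begin
    4 * (P * 2 ^ s)         ≡⟨ *-assoc 4 P (2 ^ s) ⟨
    4 * P * 2 ^ s           ≡⟨ cong (_* 2 ^ s) (*-assoc 2 2 P) ⟩
    2 ^ (2 + m) * 2 ^ s     ≡⟨ ^-distribˡ-+-* 2 (2 + m) s ⟨
    2 ^ (2 + m + s)         ≡⟨ all≡fixed+moved ⟩
    2 ^ (2 + m) + 4 * F₃    ≡⟨ cong (_+ 4 * F₃) (*-assoc 2 2 P) ⟨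
    4 * P + 4 * F₃          ≡⟨ *-distribˡ-+ 4 P F₃ ⟨
    4 * (P + F₃)            ∎)

F₇-closed-form : ∀ m s F₃ F₇ c → F₃ ≡ 2 ^ m * (2 ^ s ∸ 1) → 2 ^ (2 + m) ≡ suc c →
  c * (c ∸ 1) ≡ 6 * F₃ + 42 * F₇ → 21 * F₇ + 3 * 2 ^ m * (2 ^ s + 1) ≡ 2 ^ (2 * (2 + m) ∸ 1) + 1
F₇-closed-form m s F₃ F₇ c F₃≡ 2^n≡1+c pairs = *-cancelˡ-≡ _ _ 2 (begin
  2 * (21 * F₇ + 3 * P * (2 ^ s + 1))      ≡⟨ cong₂ (λ P S → 2 * (21 * F₇ + 3 * P * (S + 1))) P≡1+p S≡1+t ⟩
  2 * (21 * F₇ + 3 * suc p * (suc t + 1))  ≡⟨ expand-goal F₇ p t ⟩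
  6 * (suc p * t) + 42 * F₇ + 12 * suc p   ≡⟨ cong (λ F → 6 * F + 42 * F₇ + 12 * suc p) F₃≡1+p*t ⟨
  6 * F₃ + 42 * F₇ + 12 * suc p            ≡⟨ cong (_+ 12 * suc p) pairs′ ⟨
  (3 + 4 * p) * (2 + 4 * p) + 12 * suc p   ≡⟨ expand-pairs p ⟩
  2 * (8 * (suc p * suc p) + 1)            ≡⟨ cong (λ P → 2 * (8 * (P * P) + 1)) P≡1+p ⟨
  2 * (8 * (P * P) + 1)                    ≡⟨ cong (λ x → 2 * (x + 1)) (2^[2*[2+m]∸1] m) ⟨
  2 * (2 ^ (2 * (2 + m) ∸ 1) + 1)          ∎)
  where
  open ≡-Reasoning
  P p t : ℕ
  P = 2 ^ m
  p = pred P
  t = pred (2 ^ s)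
  P≡1+p : P ≡ suc p
  P≡1+p = 2^≡1+pred m
  S≡1+t : 2 ^ s ≡ suc t
  S≡1+t = 2^≡1+pred s
  F₃≡1+p*t : F₃ ≡ suc p * t
  F₃≡1+p*t = trans F₃≡ (cong₂ (λ P S → P * (S ∸ 1)) P≡1+p S≡1+t)
  c≡3+4p : c ≡ 3 + 4 * p
  c≡3+4p = suc-injective (begin
    suc c          ≡⟨ 2^n≡1+c ⟨
    2 ^ (2 + m)    ≡⟨ *-assoc 2 2 P ⟨
    4 * P          ≡⟨ cong (4 *_) P≡1+p ⟩
    4 * suc p      ≡⟨ *-suc 4 p ⟩
    4 + 4 * p      ∎)
  pairs′ : (3 + 4 * p) * (2 + 4 * p) ≡ 6 * F₃ + 42 * F₇
  pairs′ = subst (λ c → c * (c ∸ 1) ≡ 6 * F₃ + 42 * F₇) c≡3+4p pairs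
  expand-goal : ∀ f p t → 2 * (21 * f + 3 * suc p * (suc t + 1)) ≡ 6 * (suc p * t) + 42 * f + 12 * suc p
  expand-goal = solve-∀
  expand-pairs : ∀ p → (3 + 4 * p) * (2 + 4 * p) + 12 * suc p ≡ 2 * (8 * (suc p * suc p) + 1)
  expand-pairs = solve-∀

F-closed-forms : ∀ n s F₃ F₇ c → 1 ≤ s → s ≤ n →
  2 ^ (n + s) ≡ 2 ^ n + 4 * F₃ → 2 ^ n ≡ suc c → c * (c ∸ 1) ≡ 6 * F₃ + 42 * F₇ →
  (F₃ ≡ 2 ^ (n ∸ 2) * (2 ^ s ∸ 1)) × (21 * F₇ + 3 * 2 ^ (n ∸ 2) * (2 ^ s + 1) ≡ 2 ^ (2 * n ∸ 1) + 1)
F-closed-forms 1 1 F₃ _ _ _ _ 4≡2+4F₃ _ _ = contradiction (+-cancelˡ-≡ 2 2 (4 * F₃) 4≡2+4F₃) (2≢4* F₃)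
  where
  2≢4* : ∀ k → 2 ≢ 4 * k
  2≢4* zero ()
  2≢4* (suc k) 2≡4+4k with s≤s (s≤s ()) ← subst (4 ≤_) (sym 2≡4+4k) (*-monoʳ-≤ 4 (s≤s z≤n))
F-closed-forms 1 (suc (suc s)) _ _ _ _ (s≤s ()) _ _ _
F-closed-forms (suc (suc m)) s F₃ F₇ c _ _ all≡fixed+moved 2^n≡1+c pairs =
  F₃≡ , F₇-closed-form m s F₃ F₇ c F₃≡ 2^n≡1+c pairs
  where
  F₃≡ : F₃ ≡ 2 ^ m * (2 ^ s ∸ 1)
  F₃≡ = F₃-closed-form m s F₃ all≡fixed+moved

-- Involutory automorphisms of a q-Steiner triple system

module InvolutoryAutomorphism {v : ℕ} {D : List (VSet v)} (qsts : IsQSTS v D)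
  {A : Mat v} (A²≡I : A · A ≡ idMat v) (A-aut : IsAutomorphism A D) where

  act : F2V v → F2V v
  act x = vecMat x A

  act-involutive : ∀ x → act (act x) ≡ x
  act-involutive = vecMat-inverse A²≡I

  fixed : F2V v → Bool
  fixed = fixedVecᵇ A

  fixedPoint : F2V v → Bool
  fixedPoint x = not (isZero x) ∧ fixed x

  trace : F2V v → F2V v
  trace x = x ⊕ act x

  fixed⇒≡ : ∀ {x} → fixed x ≡ true → act x ≡ x
  fixed⇒≡ {x} = eqV⇒≡ {x = act x}

  fixed-zeroV : fixed (zeroV v) ≡ true
  fixed-zeroV = ≡⇒eqV (vecMat-zeroV A)

  fixed-isSubspace : IsSubspace fixed
  fixed-isSubspace = fixed-zeroV , λ x y x-fixed y-fixed →
    ≡⇒eqV (trans (vecMat-⊕ x y A) (cong₂ _⊕_ (fixed⇒≡ x-fixed) (fixed⇒≡ y-fixed)))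

  trace-fixed : ∀ x → fixed (trace x) ≡ true
  trace-fixed x = ≡⇒eqV (begin
    act (x ⊕ act x)        ≡⟨ vecMat-⊕ x (act x) A ⟩
    act x ⊕ act (act x)    ≡⟨ cong (act x ⊕_) (act-involutive x) ⟩
    act x ⊕ x              ≡⟨ ⊕-comm (act x) x ⟩
    x ⊕ act x              ∎)
    where open ≡-Reasoning

  moved⇒≢ : ∀ {x} → fixed x ≡ false → x ≢ act x
  moved⇒≢ {x} x-moved x≡xA with () ← trans (sym x-moved) (≡⇒eqV (sym x≡xA))

  moved-independent : ∀ {x} → fixed x ≡ false → Independent x (act x)
  moved-independent {x} x-moved = x≢0 , xA≢0 , moved⇒≢ x-moved
    where
    x≢0 : x ≢ zeroV v
    x≢0 refl with () ← trans (sym x-moved) fixed-zeroV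
    xA≢0 : act x ≢ zeroV v
    xA≢0 xA≡0 = x≢0 (trans (sym (act-involutive x)) (trans (cong act xA≡0) (vecMat-zeroV A)))

  trace-moved≢0 : ∀ {x} → fixed x ≡ false → trace x ≢ zeroV v
  trace-moved≢0 x-moved x+xA≡0 = moved⇒≢ x-moved (⊕≡0⇒≡ x+xA≡0)

  fixedPoint⇒≢0 : ∀ {x} → fixedPoint x ≡ true → x ≢ zeroV v
  fixedPoint⇒≢0 {x} x-fp refl with () ← trans (sym (∧-conicalˡ _ _ x-fp)) (cong not (eqV-refl (zeroV v)))

  fixedPoints-independent : ∀ {x y} → fixedPoint x ≡ true → fixedPoint y ≡ true → x ≢ y → Independent x y
  fixedPoints-independent x-fp y-fp x≢y = fixedPoint⇒≢0 x-fp , fixedPoint⇒≢0 y-fp , x≢y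

  block-isSubspace : ∀ {B} → B ∈ D → IsSubspace B
  block-isSubspace B∈D = proj₁ (All.lookup (proj₁ qsts) B∈D)

  block-count : ∀ {B} → B ∈ D → count B ≡ 8
  block-count {B} B∈D = trans (sym (card≡count B)) (proj₂ (All.lookup (proj₁ qsts) B∈D))

  blocks-through-pair : ∀ {x y} → Independent x y → length (filterᵇ (λ B → B x ∧ B y) D) ≡ 1
  blocks-through-pair {x} {y} ind = begin
    length (filterᵇ (λ B → B x ∧ B y) D)
      ≡⟨ length-filterᵇ _ D ⟩
    ∑[ B ∈ D ] ⟦ B x ∧ B y ⟧
      ≡⟨ ∑-cong-∈ D (λ B∈D → cong ⟦_⟧ (span⊆ᵇ≡∧ (block-isSubspace B∈D) x y)) ⟨
    ∑[ B ∈ D ] ⟦ span x y ⊆ᵇ B ⟧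
      ≡⟨ length-filterᵇ _ D ⟨
    length (filterᵇ (span x y ⊆ᵇ_) D)
      ≡⟨ proj₂ qsts (span x y) (span-isSubspace x y , trans (card≡count (span x y)) (count-span ind)) ⟩
    1 ∎
    where open ≡-Reasoning

  ∈image : ∀ {B w z} → act w ≡ z → B w ≡ true → image A B z ≡ true
  ∈image {w = w} refl w∈B = any-allVecs⁺ _ w (cong₂ _∧_ w∈B (eqV-refl (act w)))

  fixedBlock-closed : ∀ {B x} → fixedᵇ A B ≡ true → B x ≡ true → B (act x) ≡ true
  fixedBlock-closed {B} {x} B-fixed x∈B = trans (sym (fixedᵇ⇒≐ A B B-fixed (act x))) (∈image refl x∈B)

  StablePair : F2V v → F2V v → Set
  StablePair x y = (act x ≡ x × act y ≡ y) ⊎ (act x ≡ y × act y ≡ x)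

  stablePair-image : ∀ {B x y} → StablePair x y → (B x ∧ B y) ≡ true →
    (image A B x ∧ image A B y) ≡ true
  stablePair-image {B} {x} xy-stable xy∈B with ∧≡true (B x) xy∈B | xy-stable
  ... | x∈B , y∈B | inj₁ (xA≡x , yA≡y) = cong₂ _∧_ (∈image xA≡x x∈B) (∈image yA≡y y∈B)
  ... | x∈B , y∈B | inj₂ (xA≡y , yA≡x) = cong₂ _∧_ (∈image yA≡x y∈B) (∈image xA≡y x∈B)

  block-fixed-by-pair : ∀ {B x y} → B ∈ D → Independent x y → StablePair x y → (B x ∧ B y) ≡ true →
    fixedᵇ A B ≡ true
  block-fixed-by-pair {B} {x} {y} B∈D ind xy-stable xy∈B with proj₁ A-aut B B∈D
  ... | B′ , B′∈D , AB≐B′ = ≐⇒fixedᵇ A B (λ z → trans (AB≐B′ z) (cong (λ C → C z) (sym B≡B′)))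
    where
    B≡B′ : B ≡ B′
    B≡B′ = filterᵇ-length≡1⇒unique _ D (blocks-through-pair ind) B∈D B′∈D xy∈B
      (trans (sym (cong₂ _∧_ (AB≐B′ x) (AB≐B′ y))) (stablePair-image xy-stable xy∈B))

  same-trace⇒⊕-fixed : ∀ {x y} → trace x ≡ trace y → fixed (x ⊕ y) ≡ true
  same-trace⇒⊕-fixed {x} {y} same = ≡⇒eqV (begin
    act (x ⊕ y)                  ≡⟨ vecMat-⊕ x y A ⟩
    act x ⊕ act y                ≡⟨ cong₂ _⊕_ (act≡⊕trace x) (act≡⊕trace y) ⟩
    (x ⊕ trace x) ⊕ (y ⊕ trace y) ≡⟨ cong (λ t → (x ⊕ t) ⊕ (y ⊕ trace y)) same ⟩
    (x ⊕ trace y) ⊕ (y ⊕ trace y) ≡⟨ ⊕-interchange x (trace y) y (trace y) ⟩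
    (x ⊕ y) ⊕ (trace y ⊕ trace y) ≡⟨ cong ((x ⊕ y) ⊕_) (⊕-self (trace y)) ⟩
    (x ⊕ y) ⊕ zeroV v            ≡⟨ ⊕-identityʳ (x ⊕ y) ⟩
    x ⊕ y                        ∎)
    where
    open ≡-Reasoning
    act≡⊕trace : ∀ z → act z ≡ z ⊕ trace z
    act≡⊕trace z =
      sym (trans (sym (⊕-assoc z z (act z))) (trans (cong (_⊕ act z) (⊕-self z)) (⊕-identityˡ (act z))))

  fixedIn movedIn : VSet v → ℕ
  fixedIn B = count (λ x → B x ∧ fixed x)
  movedIn B = count (λ x → B x ∧ not (fixed x))

  module FixedBlock {B : VSet v} (B∈D : B ∈ D) (B-fixed : fixedᵇ A B ≡ true) where

    B-sub : IsSubspace B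
    B-sub = block-isSubspace B∈D

    fixedIn+movedIn≡8 : fixedIn B + movedIn B ≡ 8
    fixedIn+movedIn≡8 = trans (sym (count-split B fixed)) (block-count B∈D)

    module _ {x₀} (x₀∈B : B x₀ ≡ true) (x₀-moved : fixed x₀ ≡ false) where

      fixedIn≤movedIn : fixedIn B ≤ movedIn B
      fixedIn≤movedIn = begin
        fixedIn B
          ≡⟨ count-inverse _ (_⊕ x₀) (_⊕ x₀) (λ z → ⊕-cancelʳ z x₀) (λ z → ⊕-cancelʳ z x₀) ⟨
        count (λ z → B (z ⊕ x₀) ∧ fixed (z ⊕ x₀))
          ≤⟨ count-mono translate ⟩
        movedIn B ∎
        where
        open ≤-Reasoning
        translate : ∀ z → (B (z ⊕ x₀) ∧ fixed (z ⊕ x₀)) ≡ true → (B z ∧ not (fixed z)) ≡ true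
        translate z z+x₀∈B-fixed = cong₂ _∧_ z∈B (cong not z-moved)
          where
          z+x₀∈B : B (z ⊕ x₀) ≡ true
          z+x₀∈B = proj₁ (∧≡true (B (z ⊕ x₀)) z+x₀∈B-fixed)
          z+x₀-fixed : fixed (z ⊕ x₀) ≡ true
          z+x₀-fixed = proj₂ (∧≡true (B (z ⊕ x₀)) z+x₀∈B-fixed)
          z∈B : B z ≡ true
          z∈B = subst (λ u → B u ≡ true) (⊕-cancelʳ z x₀) (proj₂ B-sub (z ⊕ x₀) x₀ z+x₀∈B x₀∈B)
          z-moved : fixed z ≡ false
          z-moved with fixed z in z-fixed
          ... | false = refl
          ... | true with () ← trans (sym x₀-moved)
                 (subst (λ u → fixed u ≡ true) (trans (cong (_⊕ z) (⊕-comm z x₀)) (⊕-cancelʳ x₀ z))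
                   (proj₂ fixed-isSubspace (z ⊕ x₀) z z+x₀-fixed z-fixed))

      c : F2V v
      c = trace x₀

      c∈B : B c ≡ true
      c∈B = proj₂ B-sub x₀ (act x₀) x₀∈B (fixedBlock-closed B-fixed x₀∈B)

      c≢0 : c ≢ zeroV v
      c≢0 = trace-moved≢0 x₀-moved

      x₀-c-independent : Independent x₀ c
      x₀-c-independent = proj₁ (moved-independent x₀-moved) , c≢0 , x₀≢c
        where
        x₀≢c : x₀ ≢ c
        x₀≢c x₀≡c with () ← trans (sym x₀-moved) (subst (λ u → fixed u ≡ true) (sym x₀≡c) (trace-fixed x₀))

      outside-plane : ∃ λ y → (B y ∧ not (span x₀ c y)) ≡ true
      outside-plane = count-witness _ (subst (0 <_) (sym outside≡4) (s≤s z≤n))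
        where
        plane⊆B : ∀ z → (B z ∧ span x₀ c z) ≡ span x₀ c z
        plane⊆B z = ⇔→≡ (mk⇔ (∧-conicalʳ _ _)
          (λ z∈plane → cong₂ _∧_ (span⊆subspace B-sub x₀∈B c∈B z z∈plane) z∈plane))
        outside≡4 : count (λ z → B z ∧ not (span x₀ c z)) ≡ 4
        outside≡4 = +-cancelˡ-≡ 4 _ _ (begin
          4 + outside
            ≡⟨ cong (_+ outside) (trans (count-cong plane⊆B) (count-span x₀-c-independent)) ⟨
          count (λ z → B z ∧ span x₀ c z) + outside
            ≡⟨ count-split B (span x₀ c) ⟨
          count B
            ≡⟨ block-count B∈D ⟩
          8 ∎)
          where
          open ≡-Reasoning
          outside : ℕ
          outside = count (λ z → B z ∧ not (span x₀ c z))

      module OutsidePlane {y} (y∈B∖plane : (B y ∧ not (span x₀ c y)) ≡ true) where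
        y∈B : B y ≡ true
        y∈B = ∧-conicalˡ _ _ y∈B∖plane
        y∉plane : ∀ {z} → span x₀ c z ≡ true → y ≢ z
        y∉plane z∈plane refl with () ← trans (sym (cong not z∈plane)) (∧-conicalʳ _ _ y∈B∖plane)
        0∈plane : span x₀ c (zeroV v) ≡ true
        0∈plane = proj₁ (span-isSubspace x₀ c)
        x₀∈plane : span x₀ c x₀ ≡ true
        x₀∈plane = x∈span x₀ c
        c∈plane : span x₀ c c ≡ true
        c∈plane = y∈span x₀ c
        x₀⊕c∈plane : span x₀ c (x₀ ⊕ c) ≡ true
        x₀⊕c∈plane = proj₂ (span-isSubspace x₀ c) x₀ c x₀∈plane c∈plane

      -- A vector y of B outside the plane ⟨x₀, c⟩ yields a fixed vector of B independent of c:
      -- y itself, or its trace, or (when trace y = c = trace x₀) the sum y + x₀.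
      fixed-partner : ∀ {y} → (B y ∧ not (span x₀ c y)) ≡ true →
        ∃ λ w → (B w ∧ fixed w) ≡ true × Independent c w
      fixed-partner {y} y∈B∖plane with fixed y in y-fixed
      ... | true = y , cong₂ _∧_ y∈B y-fixed , c≢0 , y∉plane 0∈plane , (λ c≡y → y∉plane c∈plane (sym c≡y))
        where open OutsidePlane y∈B∖plane
      ... | false with eqV (trace y) c in trace-y≟c
      ...   | false =
        trace y , cong₂ _∧_ (proj₂ B-sub y (act y) y∈B (fixedBlock-closed B-fixed y∈B)) (trace-fixed y) ,
        c≢0 , trace-moved≢0 y-fixed , c≢trace-y
        where
        open OutsidePlane y∈B∖plane
        c≢trace-y : c ≢ trace y
        c≢trace-y c≡trace-y with () ← trans (sym trace-y≟c) (≡⇒eqV (sym c≡trace-y))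
      ...   | true =
        y ⊕ x₀ , cong₂ _∧_ (proj₂ B-sub y x₀ y∈B x₀∈B) (same-trace⇒⊕-fixed (eqV⇒≡ {x = trace y} trace-y≟c)) ,
        c≢0 , (λ y⊕x₀≡0 → y∉plane x₀∈plane (⊕≡0⇒≡ y⊕x₀≡0)) , c≢y⊕x₀
        where
        open OutsidePlane y∈B∖plane
        open ≡-Reasoning
        c≢y⊕x₀ : c ≢ y ⊕ x₀
        c≢y⊕x₀ c≡y⊕x₀ = y∉plane x₀⊕c∈plane (begin
          y              ≡⟨ ⊕-cancelʳ y x₀ ⟨
          (y ⊕ x₀) ⊕ x₀  ≡⟨ cong (_⊕ x₀) c≡y⊕x₀ ⟨
          c ⊕ x₀         ≡⟨ ⊕-comm c x₀ ⟩
          x₀ ⊕ c         ∎)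

      4≤fixedIn : 4 ≤ fixedIn B
      4≤fixedIn with fixed-partner (proj₂ outside-plane)
      ... | w , w∈B-fixed , c-w-independent =
        subst (_≤ fixedIn B) (count-span c-w-independent) (count-mono plane⊆fixedIn)
        where
        plane⊆fixedIn : ∀ z → span c w z ≡ true → (B z ∧ fixed z) ≡ true
        plane⊆fixedIn z z∈plane = let w∈B , w-fixed = ∧≡true (B w) w∈B-fixed in cong₂ _∧_
          (span⊆subspace B-sub c∈B w∈B z z∈plane)
          (span⊆subspace fixed-isSubspace (trace-fixed x₀) w-fixed z z∈plane)

      fixedIn≡4 : fixedIn B ≡ 4
      fixedIn≡4 = ≤-antisym (*-cancelˡ-≤ 2 (begin
        2 * fixedIn B             ≡⟨ cong (fixedIn B +_) (+-identityʳ (fixedIn B)) ⟩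
        fixedIn B + fixedIn B     ≤⟨ +-monoʳ-≤ (fixedIn B) fixedIn≤movedIn ⟩
        fixedIn B + movedIn B     ≡⟨ fixedIn+movedIn≡8 ⟩
        2 * 4                     ∎)) 4≤fixedIn
        where open ≤-Reasoning

    fixedIn-cases : (fixedIn B ≡ 4 × movedIn B ≡ 4) ⊎ (fixedIn B ≡ 8 × movedIn B ≡ 0)
    fixedIn-cases with movedIn B in movedIn≡
    ... | zero =
      inj₂ (trans (sym (+-identityʳ (fixedIn B))) (subst (λ m → fixedIn B + m ≡ 8) movedIn≡ fixedIn+movedIn≡8) , refl)
    ... | suc _ with count-witness (λ x → B x ∧ not (fixed x)) (subst (0 <_) (sym movedIn≡) (s≤s z≤n))
    ...   | x₀ , x₀∈B-moved = inj₁ (fixedIn≡4′ , trans (sym movedIn≡) (+-cancelˡ-≡ 4 _ _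
                                  (subst (λ f → f + movedIn B ≡ 8) fixedIn≡4′ fixedIn+movedIn≡8)))
      where
      fixedIn≡4′ : fixedIn B ≡ 4
      fixedIn≡4′ = let x₀∈B , x₀-moved = ∧≡true (B x₀) x₀∈B-moved in fixedIn≡4 x₀∈B (not-injective x₀-moved)

  fixedIn≡1+fixedPoints : ∀ {B} → B (zeroV v) ≡ true → fixedIn B ≡ suc (count (λ x → B x ∧ fixedPoint x))
  fixedIn≡1+fixedPoints {B} 0∈B =
    trans (count-split (λ x → B x ∧ fixed x) isZero) (cong₂ _+_ zero-only nonzero)
    where
    zero-only : count (λ x → (B x ∧ fixed x) ∧ isZero x) ≡ 1
    zero-only = trans (count-cong only-zero) (count-eqV (zeroV v))
      where
      only-zero : ∀ x → ((B x ∧ fixed x) ∧ isZero x) ≡ eqV x (zeroV v)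
      only-zero x = ⇔→≡ (mk⇔ (∧-conicalʳ _ _) λ x≟0 → cong₂ _∧_
        (subst (λ u → (B u ∧ fixed u) ≡ true) (sym (eqV⇒≡ {x = x} x≟0)) (cong₂ _∧_ 0∈B fixed-zeroV)) x≟0)
    nonzero : count (λ x → (B x ∧ fixed x) ∧ not (isZero x)) ≡ count (λ x → B x ∧ fixedPoint x)
    nonzero = count-cong λ x → trans (∧-assoc (B x) _ _) (cong (B x ∧_) (∧-comm (fixed x) _))

  fixedPoints≡pred-fixedIn : ∀ {B k} → B ∈ D → fixedIn B ≡ suc k → fixedPoints A B ≡ k
  fixedPoints≡pred-fixedIn B∈D fixedIn≡1+k = suc-injective (trans (cong suc (length-filterᵇ _ (allVecs v)))
    (trans (sym (fixedIn≡1+fixedPoints (proj₁ (block-isSubspace B∈D)))) fixedIn≡1+k))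

  fixedBlock-type : ∀ {B} → B ∈ D → fixedᵇ A B ≡ true →
    (fixedPoints A B ≡ 3 × movedIn B ≡ 4) ⊎ (fixedPoints A B ≡ 7 × movedIn B ≡ 0)
  fixedBlock-type B∈D B-fixed with FixedBlock.fixedIn-cases B∈D B-fixed
  ... | inj₁ (fixedIn≡4 , movedIn≡4) = inj₁ (fixedPoints≡pred-fixedIn B∈D fixedIn≡4 , movedIn≡4)
  ... | inj₂ (fixedIn≡8 , movedIn≡0) = inj₂ (fixedPoints≡pred-fixedIn B∈D fixedIn≡8 , movedIn≡0)

  countPairs : (F2V v → F2V v → Bool) → ℕ
  countPairs R = ∑ᵥ v (λ x → count (R x))

  inBlock : (F2V v → F2V v → Bool) → VSet v → ℕ
  inBlock R B = countPairs (λ x y → R x y ∧ (B x ∧ B y))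

  StableIndependent : (F2V v → F2V v → Bool) → Set
  StableIndependent R = ∀ {x y} → R x y ≡ true → Independent x y × StablePair x y

  countPairs-via-blocks : (R : F2V v → F2V v → Bool) → StableIndependent R → countPairs R ≡ ∑ D (inBlock R)
  countPairs-via-blocks R R-ok = begin
    ∑ᵥ v (λ x → ∑ᵥ v (λ y → ⟦ R x y ⟧))
      ≡⟨ ∑-cong (allVecs v) (λ x → ∑-cong (allVecs v) (one-block x)) ⟩
    ∑ᵥ v (λ x → ∑ᵥ v (λ y → ∑[ B ∈ D ] ⟦ R x y ∧ (B x ∧ B y) ⟧))
      ≡⟨ ∑-cong (allVecs v) (λ x → ∑-comm (allVecs v) D _) ⟩
    ∑ᵥ v (λ x → ∑[ B ∈ D ] ∑ᵥ v (λ y → ⟦ R x y ∧ (B x ∧ B y) ⟧))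
      ≡⟨ ∑-comm (allVecs v) D _ ⟩
    ∑ D (inBlock R) ∎
    where
    open ≡-Reasoning
    one-block : ∀ x y → ⟦ R x y ⟧ ≡ ∑[ B ∈ D ] ⟦ R x y ∧ (B x ∧ B y) ⟧
    one-block x y with R x y in Rxy
    ... | false = sym (∑-zero D)
    ... | true = trans (sym (blocks-through-pair (proj₁ (R-ok Rxy)))) (length-filterᵇ _ D)

  inBlock-unfixed : (R : F2V v → F2V v → Bool) → StableIndependent R →
    ∀ {B} → B ∈ D → fixedᵇ A B ≡ false → inBlock R B ≡ 0
  inBlock-unfixed R R-ok {B} B∈D B-unfixed =
    trans (∑-cong (allVecs v) λ x → count-none _ (never x)) (∑-zero (allVecs v))
    where
    never : ∀ x y → (R x y ∧ (B x ∧ B y)) ≡ true → ⊥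
    never x y pair = let Rxy , xy∈B = ∧≡true (R x y) pair
                         ind , xy-stable = R-ok Rxy
                     in false≢true (trans (sym B-unfixed) (block-fixed-by-pair B∈D ind xy-stable xy∈B))

  countPairs-by-type : (R : F2V v → F2V v → Bool) (a b : ℕ) → StableIndependent R →
    (∀ {B} → B ∈ D → fixedᵇ A B ≡ true → fixedPoints A B ≡ 3 → movedIn B ≡ 4 → inBlock R B ≡ a) →
    (∀ {B} → B ∈ D → fixedᵇ A B ≡ true → fixedPoints A B ≡ 7 → movedIn B ≡ 0 → inBlock R B ≡ b) →
    countPairs R ≡ a * F A D 3 + b * F A D 7
  countPairs-by-type R a b R-ok type₃ type₇ = begin
    countPairs R
      ≡⟨ countPairs-via-blocks R R-ok ⟩
    ∑ D (inBlock R)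
      ≡⟨ ∑-cong-∈ D by-type ⟩
    ∑[ B ∈ D ] (a * ⟦ ofType 3 B ⟧ + b * ⟦ ofType 7 B ⟧)
      ≡⟨ ∑-distrib-+ D _ _ ⟩
    ∑[ B ∈ D ] (a * ⟦ ofType 3 B ⟧) + ∑[ B ∈ D ] (b * ⟦ ofType 7 B ⟧)
      ≡⟨ cong₂ _+_ (∑-*ˡ D a _) (∑-*ˡ D b _) ⟩
    a * ∑[ B ∈ D ] ⟦ ofType 3 B ⟧ + b * ∑[ B ∈ D ] ⟦ ofType 7 B ⟧
      ≡⟨ cong₂ (λ m n → a * m + b * n) (length-filterᵇ _ D) (length-filterᵇ _ D) ⟨
    a * F A D 3 + b * F A D 7 ∎
    where
    open ≡-Reasoning
    ofType : ℕ → VSet v → Bool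
    ofType k B = fixedᵇ A B ∧ (fixedPoints A B ≡ᵇ k)
    by-type : ∀ {B} → B ∈ D → inBlock R B ≡ a * ⟦ ofType 3 B ⟧ + b * ⟦ ofType 7 B ⟧
    by-type {B} B∈D with fixedᵇ A B in B-fixed
    ... | false = trans (inBlock-unfixed R R-ok B∈D B-fixed) (sym (cong₂ _+_ (*-zeroʳ a) (*-zeroʳ b)))
    ... | true with fixedBlock-type B∈D B-fixed
    ...   | inj₁ (fp≡3 , moved≡4) rewrite fp≡3 =
            trans (type₃ B∈D B-fixed fp≡3 moved≡4)
              (sym (trans (cong₂ _+_ (*-identityʳ a) (*-zeroʳ b)) (+-identityʳ a)))
    ...   | inj₂ (fp≡7 , moved≡0) rewrite fp≡7 =
            trans (type₇ B∈D B-fixed fp≡7 moved≡0) (sym (cong₂ _+_ (*-zeroʳ a) (*-identityʳ b)))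

  moved-count : count (λ x → not (fixed x)) ≡ 4 * F A D 3
  moved-count = begin
    count (λ x → not (fixed x))
      ≡⟨ ∑-cong (allVecs v) (λ x → count-eqV∧ (act x) (λ _ → not (fixed x))) ⟨
    countPairs swapped
      ≡⟨ countPairs-by-type swapped 4 0 swapped-ok (λ _ B-fixed _ → trans (in-fixedBlock B-fixed))
                                                   (λ _ B-fixed _ → trans (in-fixedBlock B-fixed)) ⟩
    4 * F A D 3 + 0 * F A D 7
      ≡⟨ +-identityʳ _ ⟩
    4 * F A D 3 ∎
    where
    open ≡-Reasoning
    swapped : F2V v → F2V v → Bool
    swapped x y = eqV y (act x) ∧ not (fixed x)
    swapped-ok : StableIndependent swapped
    swapped-ok {x} {y} x↦y = let y≟xA , x-moved = ∧≡true (eqV y (act x)) x↦y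
                                 xA≡y = sym (eqV⇒≡ {x = y} y≟xA)
                             in subst (Independent x) xA≡y (moved-independent (not-injective x-moved)) ,
                                inj₂ (xA≡y , trans (cong act (sym xA≡y)) (act-involutive x))
    in-fixedBlock : ∀ {B} → fixedᵇ A B ≡ true → inBlock swapped B ≡ movedIn B
    in-fixedBlock {B} B-fixed = ∑-cong (allVecs v) λ x →
      trans (count-cong (λ y → ∧-assoc (eqV y (act x)) _ _))
        (trans (count-eqV∧ (act x) (λ y → not (fixed x) ∧ (B x ∧ B y))) (cong ⟦_⟧ (⇔→≡ (mk⇔ (to x) (from x)))))
      where
      to : ∀ x → (not (fixed x) ∧ (B x ∧ B (act x))) ≡ true → (B x ∧ not (fixed x)) ≡ true
      to x moved-pair = let x-moved , pair∈B = ∧≡true (not (fixed x)) moved-pair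
                        in cong₂ _∧_ (proj₁ (∧≡true (B x) pair∈B)) x-moved
      from : ∀ x → (B x ∧ not (fixed x)) ≡ true → (not (fixed x) ∧ (B x ∧ B (act x))) ≡ true
      from x x∈B-moved = let x∈B , x-moved = ∧≡true (B x) x∈B-moved
                         in cong₂ _∧_ x-moved (cong₂ _∧_ x∈B (fixedBlock-closed B-fixed x∈B))

  fixedPoint-pairs : count fixedPoint * (count fixedPoint ∸ 1) ≡ 6 * F A D 3 + 42 * F A D 7
  fixedPoint-pairs = begin
    count fixedPoint * (count fixedPoint ∸ 1)
      ≡⟨ count-distinct-pairs fixedPoint ⟨
    countPairs distinct
      ≡⟨ countPairs-by-type distinct 6 42 distinct-ok
           (λ {B} _ _ fp≡3 _ → trans (in-block {B}) (cong (λ n → n * (n ∸ 1)) fp≡3))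
           (λ {B} _ _ fp≡7 _ → trans (in-block {B}) (cong (λ n → n * (n ∸ 1)) fp≡7)) ⟩
    6 * F A D 3 + 42 * F A D 7 ∎
    where
    open ≡-Reasoning
    distinct : F2V v → F2V v → Bool
    distinct x y = fixedPoint x ∧ (fixedPoint y ∧ not (eqV y x))
    distinct-ok : StableIndependent distinct
    distinct-ok {x} {y} x≠y =
      let x-fp , rest = ∧≡true (fixedPoint x) x≠y
          y-fp , y≠x = ∧≡true (fixedPoint y) rest
      in fixedPoints-independent x-fp y-fp (λ { refl → false≢true (trans (sym (cong not (eqV-refl x))) y≠x) }) ,
         inj₁ (fixed⇒≡ (proj₂ (∧≡true (not (isZero x)) x-fp)) , fixed⇒≡ (proj₂ (∧≡true (not (isZero y)) y-fp)))
    rearrange : ∀ p q r b c → ((p ∧ (q ∧ r)) ∧ (b ∧ c)) ≡ ((b ∧ p) ∧ ((c ∧ q) ∧ r))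
    rearrange p q r false c = ∧-zeroʳ _
    rearrange p q r true false = trans (∧-zeroʳ _) (sym (∧-zeroʳ p))
    rearrange p q r true true = ∧-identityʳ _
    in-block : ∀ {B} → inBlock distinct B ≡ fixedPoints A B * (fixedPoints A B ∸ 1)
    in-block {B} = begin
      inBlock distinct B
        ≡⟨ ∑-cong (allVecs v) (λ x → count-cong λ y → rearrange (fixedPoint x) (fixedPoint y) _ (B x) (B y)) ⟩
      countPairs (λ x y → (B x ∧ fixedPoint x) ∧ ((B y ∧ fixedPoint y) ∧ not (eqV y x)))
        ≡⟨ count-distinct-pairs (λ x → B x ∧ fixedPoint x) ⟩
      fp * (fp ∸ 1)
        ≡⟨ cong (λ n → n * (n ∸ 1)) (length-filterᵇ _ (allVecs v)) ⟨
      fixedPoints A B * (fixedPoints A B ∸ 1) ∎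
      where
      fp : ℕ
      fp = count (λ x → B x ∧ fixedPoint x)

  count-fixed≡1+fixedPoints : count fixed ≡ suc (count fixedPoint)
  count-fixed≡1+fixedPoints = fixedIn≡1+fixedPoints {λ _ → true} refl

lemma9 : (v s : ℕ) → 2 * s ≤ v → (D : List (VSet v)) → IsQSTS v D →
    (A : Mat v) → IsInvertible A → HasOrder2 A → Conjugate A (Avs v s) →
    IsAutomorphism A D →
    ((B : VSet v) → B ∈ D → fixedᵇ A B ≡ true →
      (fixedPoints A B ≡ 3) ⊎ (fixedPoints A B ≡ 7))
    × (F A D 3 ≡ 2 ^ (v ∸ s ∸ 2) * (2 ^ s ∸ 1))
    × (21 * F A D 7 + 3 * 2 ^ (v ∸ s ∸ 2) * (2 ^ s + 1) ≡ 2 ^ (2 * v ∸ 2 * s ∸ 1) + 1)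
lemma9 v s 2s≤v D qsts A _ (A²≡I , A≢I) A~Avs A-aut =
  (λ B B∈D B-fixed → Sum.map proj₁ proj₁ (fixedBlock-type B∈D B-fixed)) ,
  proj₁ closed-forms ,
  subst (λ e → 21 * F A D 7 + 3 * 2 ^ (v ∸ s ∸ 2) * (2 ^ s + 1) ≡ 2 ^ (e ∸ 1) + 1)
    (*-distribˡ-∸ 2 v s) (proj₂ closed-forms)
  where
  open InvolutoryAutomorphism qsts A²≡I A-aut
  open ≡-Reasoning
  count-fixed : count fixed ≡ 2 ^ (v ∸ s)
  count-fixed = let P , Q , PQ≡I , QP≡I , A≡QMP = A~Avs
                in trans (count-fixedVec-conj PQ≡I QP≡I A≡QMP) (count-fixedVec-Avs v s 2s≤v)
  all≡fixed+moved : 2 ^ (v ∸ s + s) ≡ 2 ^ (v ∸ s) + 4 * F A D 3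
  all≡fixed+moved = begin
    2 ^ (v ∸ s + s)                             ≡⟨ cong (2 ^_) (m∸n+n≡m (≤-trans (m≤n*m s 2) 2s≤v)) ⟩
    2 ^ v                                       ≡⟨ count-true v ⟨
    count {v} (λ _ → true)                      ≡⟨ count-split (λ _ → true) fixed ⟩
    count fixed + count (λ x → not (fixed x))   ≡⟨ cong₂ _+_ count-fixed moved-count ⟩
    2 ^ (v ∸ s) + 4 * F A D 3                   ∎
  closed-forms : (F A D 3 ≡ 2 ^ (v ∸ s ∸ 2) * (2 ^ s ∸ 1)) ×
                 (21 * F A D 7 + 3 * 2 ^ (v ∸ s ∸ 2) * (2 ^ s + 1) ≡ 2 ^ (2 * (v ∸ s) ∸ 1) + 1)
  closed-forms = F-closed-forms (v ∸ s) s (F A D 3) (F A D 7) (count fixedPoint)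
    (conjugate-Avs⇒1≤s v s A≢I A~Avs) (m+n≤o⇒m≤o∸n s (subst (_≤ v) (cong (s +_) (+-identityʳ s)) 2s≤v))
    all≡fixed+moved (trans (sym count-fixed) count-fixed≡1+fixedPoints) fixedPoint-pairs
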